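{- Let $X$ be a finite nonempty set and let $\mathcal F$ and $\mathcal F'$ be forests on $X$. Then there exists a cherry picking sequence $\sigma$ for $\mathcal F$ and $\mathcal F'$ of length $m$ for some $m\ge |X|$.
   Context: All graphs are finite multigraphs without loops. A leaf is a vertex of degree at most one. Suppressing a degree-two vertex $v$ with incident edges $\{u,v\},\{v,w\}$, $u\neq w$, means deleting $v$ and these edges and adding $\{u,w\}$. A phylogenetic tree on a finite nonempty set $Y$ is a tree whose set of leaves is exactly $Y$ and in which every non-leaf vertex has degree three (for $Y=\{y\}$ the single vertex $y$). A forest on $X$ is a set of phylogenetic trees whose leaf sets are pairwise disjoint with union $X$. Forest notions: a cherry of a phylogenetic tree $\mathcal T$ is a pair $(x,y)$ of distinct leaves such that either $\mathcal T$ is the single edge $\{x,y\}$ or $x,y$ are adjacent to a common vertex; a cherry of a forest is a cherry of one of its trees. For a leaf $x$, $e_x$ denotes the edge containing $x$. A phylogenetic tree $\mathcal S$ is a proper pendant subtree of a tree $\mathcal T$ if there is a cut-edge $e$ of $\mathcal T$ such that $\mathcal S$ equals one of the two components obtained by deleting $e$ and suppressing degree-two vertices; this edge is denoted $e_{\mathcal S}$ (for $\mathcal S$ a single leaf $p$, $e_{\mathcal S}=e_p$). $((x,y),p)$ denotes a proper pendant subtree with leaf set $\{x,y,p\}$ in which $(x,y)$ is a cherry, and $((x,y),(p,q))$ one with leaf set $\{x,y,p,q\}$ in which $(x,y)$ and $(p,q)$ are cherries; $(p,q)$ also denotes the two-leaf pendant subtree on $\{p,q\}$. For an edge $e$ of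 a tree $\mathcal T_e$ in a forest $\mathcal F$, $\mathcal F-e$ replaces $\mathcal T_e$ by the trees obtained from $\mathcal T_e$ by deleting $e$ and suppressing degree-two vertices. For $x\in X$, $|X|\ge2$, with $\mathcal T_x$ the tree containing $x$, $\mathcal F-x$ removes $\mathcal T_x$ if it is the single vertex $x$ and otherwise replaces $\mathcal T_x$ by the tree obtained by deleting $x$ and $e_x$ and suppressing the resulting degree-two vertex. Cherry picking sequence: for forests $\mathcal F,\mathcal F'$ on $X$, a sequence $\sigma=(x_1,\dots,x_m)$ of elements of $X$, $m\ge|X|\ge1$, is a cherry picking sequence for $\mathcal F$ and $\mathcal F'$ (of length $m$) if there are forests $\mathcal F[i],\mathcal F'[i]$, $1\le i\le m$, with $\mathcal F[1]=\mathcal F$, $\mathcal F'[1]=\mathcal F'$, $\mathcal F[m]=\mathcal F'[m]=\{x_m\}$, and for each $1\le i\le m-1$ precisely one of: (C1) $(x_i,y)$ is a cherry in both $\mathcal F[i]$ and $\mathcal F'[i]$ for some $y$, and $\mathcal F[i+1]=\mathcal F[i]-x_i$, $\mathcal F'[i+1]=\mathcal F'[i]-x_i$; (C2) $(x_i,y)$ is a cherry in $\mathcal F[i]$ for some $y$ and one of: (a) $(x_i,z)$ is a cherry in $\mathcal F'[i]$ with $z\ne y$, $\mathcal F'[i+1]=\mathcal F'[i]$, and either (i) $\mathcal F[i+1]$ is $\mathcal F[i]-e_{x_i}$ or $\mathcal F[i]-e_y$, or (ii) $((x_i,y),p)$ is a proper pendant subtree of a tree in $\mathcal F[i]$, $p\in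 X$, and $\mathcal F[i+1]=\mathcal F[i]-e_{\mathcal S}$ for some $\mathcal S\in\{p,((x_i,y),p)\}$, or (iii) $((x_i,y),(p,q))$ is a proper pendant subtree of a tree in $\mathcal F[i]$, $p\ne q\in X$, and $\mathcal F[i+1]=\mathcal F[i]-e_{\mathcal S}$ for some $\mathcal S\in\{p,q,(p,q)\}$; (b) $x_i,y$ are leaves of one tree $\mathcal T'\in\mathcal F'[i]$, neither in a cherry of $\mathcal T'$, and either (i) $\mathcal F'[i+1]=\mathcal F'[i]$ and $\mathcal F[i+1]$ is $\mathcal F[i]-e_{x_i}$ or $\mathcal F[i]-e_y$, or (ii) for $e$ the edge of $\mathcal T'$ containing the vertex adjacent to $x_i$ and not on the path between $x_i$ and $y$, $\mathcal F'[i+1]=\mathcal F'[i]-e$ and $\mathcal F[i+1]=\mathcal F[i]$; (c) $x_i,y$ lie in different trees of $\mathcal F'[i]$, neither is an isolated vertex or in a cherry of $\mathcal F'[i]$, $\mathcal F'[i+1]=\mathcal F'[i]$, and $\mathcal F[i+1]$ is $\mathcal F[i]-e_{x_i}$ or $\mathcal F[i]-e_y$; or the same with the roles of $\mathcal F$ and $\mathcal F'$ reversed; (C3) $x_i$ is a single-vertex component of $\mathcal F[i]$, $\mathcal F[i+1]=\mathcal F[i]-x_i$ and $\mathcal F'[i+1]=\mathcal F'[i]-x_i$, or the same with the roles of $\mathcal F$ and $\mathcal F'$ reversed. -}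

module Defs where

open import Data.Nat using (ℕ; _≤_)
open import Data.Fin using (Fin)
import Data.Fin as Fin
import Data.Nat as Nat
open import Data.Sum using (_⊎_; inj₁; inj₂)
open import Data.Sum.Properties using (≡-dec)
open import Data.Product using (_×_; _,_; proj₁; proj₂; Σ; ∃; ∃-syntax)
open import Data.List using (List; []; _∷_; [_]; length; filter; foldr)
open import Data.List.Relation.Unary.Any using (Any; _─_)
open import Data.List.Membership.Propositional using (_∈_)
open import Data.List.Relation.Unary.Unique.Propositional using (Unique)
open import Relation.Binary.PropositionalEquality using (_≡_; _≢_)
open import Relation.Binary.Definitions using (DecidableEquality)
open import Relation.Nullary using (¬_; Dec; yes; no; ¬?)
open import Relation.Nullary.Decidable using (_⊎-dec_)
open import Function using (_∘_; _⇔_)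

-- The label set X is Fin n.  Vertices of a forest are either labels
-- (inj₁ x, x ∈ X; these are the leaves) or internal vertices (inj₂ k).

module _ {n : ℕ} where

  V : Set
  V = Fin n ⊎ ℕ

  _≟V_ : DecidableEquality V
  _≟V_ = ≡-dec Fin._≟_ Nat._≟_

  Edge : Set
  Edge = V × V

  -- A finite loopless multigraph: a vertex list and an edge list
  -- (an edge (a , b) stands for the unordered pair {a,b}; the list is a
  -- multiset of edges).
  record Graph : Set where
    constructor graph
    field
      verts : List V
      edges : List Edge
  open Graph public

  Incident : V → Edge → Set
  Incident v (a , b) = a ≡ v ⊎ b ≡ v

  Incident? : (v : V) (e : Edge) → Dec (Incident v e)
  Incident? v (a , b) = (a ≟V v) ⊎-dec (b ≟V v)

  deg : Graph → V → ℕ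
  deg G v = length (filter (Incident? v) (edges G))

  Adj : Graph → V → V → Set
  Adj G u w = (u , w) ∈ edges G ⊎ (w , u) ∈ edges G

  data Conn (G : Graph) : V → V → Set where
    here  : ∀ {u} → u ∈ verts G → Conn G u u
    there : ∀ {u w v} → Adj G u w → Conn G w v → Conn G u v

  removeEdge : (G : Graph) {e : Edge} → e ∈ edges G → Graph
  removeEdge G p = graph (verts G) (edges G ─ p)

  other : V → Edge → V
  other v (a , b) with a ≟V v
  ... | yes _ = b
  ... | no  _ = a

  suppressV : V → Graph → Graph
  suppressV v G with filter (Incident? v) (edges G)
  ... | e₁ ∷ e₂ ∷ [] with other v e₁ ≟V other v e₂
  ...   | yes _ = G
  ...   | no  _ = graph (filter (λ u → ¬? (u ≟V v)) (verts G))
                        ((other v e₁ , other v e₂) ∷ filter (λ e → ¬? (Incident? v e)) (edges G))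
  suppressV v G | _ = G

  -- suppress all degree-two vertices (suppression preserves the degrees of
  -- the remaining vertices, so one pass over the vertex list suffices)
  suppressAll : Graph → Graph
  suppressAll G = foldr suppressV G (verts G)

  deleteEdge : (G : Graph) {e : Edge} → e ∈ edges G → Graph
  deleteEdge G p = suppressAll (removeEdge G p)

  deleteLeaf : Graph → Fin n → Graph
  deleteLeaf G x = suppressAll
    (graph (filter (λ u → ¬? (u ≟V inj₁ x)) (verts G))
           (filter (λ e → ¬? (Incident? (inj₁ x) e)) (edges G)))

  IsForestOnX : Graph → Set
  IsForestOnX G =
      Unique (verts G)
    × (∀ {a b} → (a , b) ∈ edges G → a ∈ verts G × b ∈ verts G × a ≢ b)
    -- acyclic: every edge is a cut-edge
    × (∀ {a b} (p : (a , b) ∈ edges G) → ¬ Conn (removeEdge G p) a b)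
    -- the leaf set is exactly X
    × (∀ (x : Fin n) → inj₁ x ∈ verts G)
    × (∀ (x : Fin n) → deg G (inj₁ x) ≤ 1)
    × (∀ (k : ℕ) → inj₂ k ∈ verts G → deg G (inj₂ k) ≡ 3)

  Cherry : Graph → Fin n → Fin n → Set
  Cherry G x y = x ≢ y
    × (Adj G (inj₁ x) (inj₁ y) ⊎ ∃[ c ] (Adj G (inj₁ x) c × Adj G (inj₁ y) c))

  InCherry : Graph → Fin n → Set
  InCherry G x = ∃[ y ] Cherry G x y

  Isolated : Graph → Fin n → Set
  Isolated G x = inj₁ x ∈ verts G × deg G (inj₁ x) ≡ 0

  IsLeafEdge : Fin n → Edge → Set
  IsLeafEdge x e = Incident (inj₁ x) e

  CutsOff : (G : Graph) {e : Edge} → e ∈ edges G → List (Fin n) → Set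
  CutsOff G {a , b} p L = Σ V λ s → (s ≡ a ⊎ s ≡ b)
    × (∀ (z : Fin n) → Conn (removeEdge G p) s (inj₁ z) ⇔ z ∈ L)

  -- ((x,y),p) is a proper pendant subtree with e_S the edge at position q
  Pendant3 : (G : Graph) → Fin n → Fin n → Fin n → {e : Edge} → e ∈ edges G → Set
  Pendant3 G x y p q = Unique (x ∷ y ∷ p ∷ [])
    × CutsOff G q (x ∷ y ∷ p ∷ []) × Cherry (deleteEdge G q) x y

  -- ((x,y),(p,r)) is a proper pendant subtree with e_S the edge at position q
  Pendant4 : (G : Graph) → Fin n → Fin n → Fin n → Fin n → {e : Edge} → e ∈ edges G → Set
  Pendant4 G x y p r q = Unique (x ∷ y ∷ p ∷ r ∷ [])
    × CutsOff G q (x ∷ y ∷ p ∷ r ∷ [])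
    × Cherry (deleteEdge G q) x y × Cherry (deleteEdge G q) p r

  -- (p,r) is a proper pendant subtree with e_S the edge at position q
  Pendant2 : (G : Graph) → Fin n → Fin n → {e : Edge} → e ∈ edges G → Set
  Pendant2 G p r q = p ≢ r × CutsOff G q (p ∷ r ∷ [])

  -- Rule (C2), in the orientation where the cherry (x,y) lies in F.
  -- Indices: F[i], F'[i], F[i+1], F'[i+1].

  data C2 (x : Fin n) (F F' : Graph) : Graph → Graph → Set where
    a-i : ∀ {y z e} → Cherry F x y → Cherry F' x z → z ≢ y
        → (q : e ∈ edges F) → IsLeafEdge x e ⊎ IsLeafEdge y e
        → C2 x F F' (deleteEdge F q) F'
    a-ii : ∀ {y z p e e'} → Cherry F x y → Cherry F' x z → z ≢ y
        → (r : e ∈ edges F) → Pendant3 F x y p r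
        → (q : e' ∈ edges F) → IsLeafEdge p e' ⊎ Pendant3 F x y p q
        → C2 x F F' (deleteEdge F q) F'
    a-iii : ∀ {y z p p' e e'} → Cherry F x y → Cherry F' x z → z ≢ y
        → (r : e ∈ edges F) → Pendant4 F x y p p' r
        → (q : e' ∈ edges F)
        → IsLeafEdge p e' ⊎ IsLeafEdge p' e' ⊎ Pendant2 F p p' q
        → C2 x F F' (deleteEdge F q) F'
    b-i : ∀ {y e} → Cherry F x y
        → Conn F' (inj₁ x) (inj₁ y) → ¬ InCherry F' x → ¬ InCherry F' y
        → (q : e ∈ edges F) → IsLeafEdge x e ⊎ IsLeafEdge y e
        → C2 x F F' (deleteEdge F q) F'
    b-ii : ∀ {y c e} → Cherry F x y
        → Conn F' (inj₁ x) (inj₁ y) → ¬ InCherry F' x → ¬ InCherry F' y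
        → Adj F' (inj₁ x) c
        → (q : e ∈ edges F') → Incident c e
        → Conn (removeEdge F' q) (inj₁ x) (inj₁ y)   -- e is not on the x–y path
        → C2 x F F' F (deleteEdge F' q)
    c : ∀ {y e} → Cherry F x y
        → ¬ Conn F' (inj₁ x) (inj₁ y)
        → ¬ Isolated F' x → ¬ Isolated F' y
        → ¬ InCherry F' x → ¬ InCherry F' y
        → (q : e ∈ edges F) → IsLeafEdge x e ⊎ IsLeafEdge y e
        → C2 x F F' (deleteEdge F q) F'

  data Step (x : Fin n) (F F' : Graph) : Graph → Graph → Set where
    C1 : ∀ {y} → Cherry F x y → Cherry F' x y
       → Step x F F' (deleteLeaf F x) (deleteLeaf F' x)
    C2→ : ∀ {G G'} → C2 x F F' G G' → Step x F F' G G'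
    C2← : ∀ {G G'} → C2 x F' F G' G → Step x F F' G G'
    C3→ : Isolated F x → Step x F F' (deleteLeaf F x) (deleteLeaf F' x)
    C3← : Isolated F' x → Step x F F' (deleteLeaf F x) (deleteLeaf F' x)

  IsSingleton : Graph → Fin n → Set
  IsSingleton G x = (∀ v → v ∈ verts G ⇔ v ≡ inj₁ x) × edges G ≡ []

  data CPS (F F' : Graph) : List (Fin n) → Set where
    last : ∀ {x} → IsSingleton F x → IsSingleton F' x → CPS F F' [ x ]
    step : ∀ {x G G' σ} → Step x F F' G G' → CPS G G' σ → CPS F F' (x ∷ σ)

  IsCherryPickingSequence : Graph → Graph → List (Fin n) → Set
  IsCherryPickingSequence F F' σ = n ≤ length σ × CPS F F' σ

-- A forest with an edge has a cherry: walk along an edge into an internal vertex and keep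
-- leaving each degree-three vertex by an edge other than the one just used. Acyclicity means
-- no edge is used twice, so the walk stops at a vertex whose two other neighbours are leaves.
-- Given a cherry (x , y) of one forest, the way x and y sit in the other forest decides which of
-- (C1), (C2)(a)(i), (C2)(b)(i), (C2)(c) and (C3) applies; each deletes a leaf or an edge, and
-- deleting and then suppressing keeps a forest on the remaining labels. When neither forest has
-- an edge, (C3) removes isolated leaves. So the number of labels plus the number of edges of
-- both forests decreases at every step, until both forests are the single leaf of the last label.

module Submission where

open import Defs
open import Data.Bool using (true; false)
open import Data.Empty using (⊥-elim)
open import Data.Fin as Fin using (Fin)
import Data.Fin.Properties as FinP
open import Data.List using (List; []; _∷_; [_]; _++_; length; filter; foldr; allFin)
open import Data.List.Properties
  using ( length-tabulate; length-++; filter-++; length-filter; filter-notAll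
        ; filter-all; filter-accept; filter-reject; length-removeAt′)
open import Data.List.Membership.Propositional using (_∈_; _∉_; lose)
open import Data.List.Membership.Propositional.Properties using (∈-allFin; ∈-filter⁺; ∈-filter⁻)
open import Data.List.Membership.DecPropositional using (_∈?_)
open import Data.List.Relation.Unary.All as All using ([]; _∷_)
open import Data.List.Relation.Unary.All.Properties using (¬Any⇒All¬; All¬⇒¬Any)
open import Data.List.Relation.Unary.AllPairs using ([]; _∷_)
open import Data.List.Relation.Unary.Any as Any using (here; there; index; _─_)
open import Data.List.Relation.Unary.Unique.Propositional using (Unique)
open import Data.List.Relation.Unary.Unique.Propositional.Properties using (allFin⁺; filter⁺)
open import Data.Nat as ℕ using (ℕ; suc; _≤_; _<_; _+_; s≤s)
open import Data.Nat.Properties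
open import Data.Product as Product using (Σ; _×_; _,_; proj₁; proj₂; ∃; ∃₂)
open import Data.Product.Properties using (≡-dec)
open import Data.Sum as Sum using (_⊎_; inj₁; inj₂; [_,_]′)
open import Data.Sum.Properties using (inj₁-injective)
open import Function using (_∘_; id; mk⇔)
open import Level using (0ℓ)
open import Relation.Binary.Construct.Closure.ReflexiveTransitive as Star using (Star; ε; _◅_; _◅◅_)
open import Relation.Binary.Construct.Closure.Symmetric as Sym using (SymClosure; fwd; bwd)
open import Relation.Binary.Definitions using (DecidableEquality)
open import Relation.Binary.PropositionalEquality hiding ([_])
open import Relation.Nullary using (¬_; Dec; yes; no; does; ¬?)
open import Relation.Nullary.Decidable using (map′; _×-dec_; _⊎-dec_)
open import Relation.Unary using (Pred; Decidable)

module _ {A : Set} where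

  ∈-─⁻ : ∀ {e f : A} {xs} (p : e ∈ xs) → f ∈ (xs ─ p) → f ∈ xs
  ∈-─⁻ (here refl) m = there m
  ∈-─⁻ (there p) (here refl) = here refl
  ∈-─⁻ (there p) (there m) = there (∈-─⁻ p m)

  ∈-─⁺ : ∀ {e f : A} {xs} (p : e ∈ xs) → f ∈ xs → f ≢ e → f ∈ (xs ─ p)
  ∈-─⁺ (here refl) (here refl) f≢e = ⊥-elim (f≢e refl)
  ∈-─⁺ (here refl) (there m) _ = m
  ∈-─⁺ (there p) (here refl) _ = here refl
  ∈-─⁺ (there p) (there m) f≢e = there (∈-─⁺ p m f≢e)

  ≢⇒∉[] : ∀ {x y : A} → x ≢ y → x ∉ [ y ]
  ≢⇒∉[] x≢y (here x≡y) = x≢y x≡y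

  length-─ : ∀ {e : A} {xs} (p : e ∈ xs) → length xs ≡ suc (length (xs ─ p))
  length-─ {xs = xs} p = length-removeAt′ xs (index p)

  Unique-─ : ∀ {e : A} {xs} → Unique xs → (p : e ∈ xs) → Unique (xs ─ p)
  Unique-─ (_ ∷ u) (here refl) = u
  Unique-─ (x∉ ∷ u) (there p) = ¬Any⇒All¬ _ (All¬⇒¬Any x∉ ∘ ∈-─⁻ p) ∷ Unique-─ u p

  ∉-─⇒Unique : ∀ {xs : List A} → (∀ {x} (p : x ∈ xs) → x ∉ (xs ─ p)) → Unique xs
  ∉-─⇒Unique {[]} _ = []
  ∉-─⇒Unique {x ∷ xs} h = ¬Any⇒All¬ xs (h (here refl)) ∷ ∉-─⇒Unique (λ p m → h (there p) (there m))

  other-two : ∀ {e : A} {xs} → length xs ≡ 3 → Unique xs → e ∈ xs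
            → ∃₂ λ f₁ f₂ → f₁ ∈ xs × f₂ ∈ xs × f₁ ≢ e × f₂ ≢ e × f₁ ≢ f₂
  other-two {xs = _ ∷ _ ∷ _ ∷ []} refl ((x≢y ∷ x≢z ∷ []) ∷ (y≢z ∷ []) ∷ [] ∷ []) (here refl) =
    _ , _ , there (here refl) , there (there (here refl)) , x≢y ∘ sym , x≢z ∘ sym , y≢z
  other-two {xs = _ ∷ _ ∷ _ ∷ []} refl ((x≢y ∷ x≢z ∷ []) ∷ (y≢z ∷ []) ∷ [] ∷ []) (there (here refl)) =
    _ , _ , here refl , there (there (here refl)) , x≢y , y≢z ∘ sym , x≢z
  other-two {xs = _ ∷ _ ∷ _ ∷ []} refl ((x≢y ∷ x≢z ∷ []) ∷ (y≢z ∷ []) ∷ [] ∷ []) (there (there (here refl))) =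
    _ , _ , here refl , there (here refl) , x≢z , y≢z , x≢y

module _ {A : Set} {P : Pred A 0ℓ} (P? : Decidable P) where

  count : List A → ℕ
  count xs = length (filter P? xs)

  count-++ : ∀ xs ys → count (xs ++ ys) ≡ count xs + count ys
  count-++ xs ys = trans (cong length (filter-++ P? xs ys)) (length-++ (filter P? xs))

  count-─ : ∀ {e : A} {xs} (p : e ∈ xs) → count (xs ─ p) ≤ count xs × count xs ≤ suc (count (xs ─ p))
  count-─ {xs = x ∷ _} (here refl) with does (P? x)
  ... | true = n≤1+n _ , ≤-refl
  ... | false = ≤-refl , n≤1+n _
  count-─ {xs = x ∷ _} (there p) with does (P? x) | count-─ p
  ... | true | (lo , hi) = s≤s lo , s≤s hi
  ... | false | lo-hi = lo-hi

  count-pair : ∀ {x y z} → (P z → P x ⊎ P y) → (P x → P z) → (P y → P z) → ¬ (P x × P y)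
             → count (x ∷ y ∷ []) ≡ count [ z ]
  count-pair {x} {y} {z} split inl inr disjoint with P? x
  ... | yes px with P? y
  ...   | yes py = ⊥-elim (disjoint (px , py))
  ...   | no _ with P? z
  ...     | yes _ = refl
  ...     | no ¬pz = ⊥-elim (¬pz (inl px))
  count-pair {x} {y} {z} split inl inr disjoint | no ¬px with P? y
  ...   | yes py with P? z
  ...     | yes _ = refl
  ...     | no ¬pz = ⊥-elim (¬pz (inr py))
  count-pair {x} {y} {z} split inl inr disjoint | no ¬px | no ¬py with P? z
  ...     | yes pz = ⊥-elim ([ ¬px , ¬py ]′ (split pz))
  ...     | no _ = refl

  module _ {Q : Pred A 0ℓ} (Q? : Decidable Q) where

    count-partition : ∀ xs → count xs ≡ count (filter Q? xs) + count (filter (¬? ∘ Q?) xs)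
    count-partition [] = refl
    count-partition (x ∷ xs) with Q? x
    ... | yes _ with P? x
    ...   | yes _ = cong suc (count-partition xs)
    ...   | no _ = count-partition xs
    count-partition (x ∷ xs) | no _ with P? x
    ...   | yes _ = trans (cong suc (count-partition xs)) (sym (+-suc _ _))
    ...   | no _ = count-partition xs

    count-filter≤ : ∀ xs → count (filter Q? xs) ≤ count xs
    count-filter≤ xs = subst (count (filter Q? xs) ≤_) (sym (count-partition xs)) (m≤m+n _ _)

-- Reachability

module _ {n : ℕ} where

  _≟E_ : DecidableEquality (Edge {n})
  _≟E_ = ≡-dec _≟V_ _≟V_

  EdgeSet : Set₁
  EdgeSet = Edge {n} → Set

  InList : List (Edge {n}) → EdgeSet
  InList es g = g ∈ es

  _∖_ : EdgeSet → Edge {n} → EdgeSet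
  (E ∖ f) g = E g × g ≢ f

  Reach : EdgeSet → V {n} → V {n} → Set
  Reach E = Star (SymClosure (λ a b → E (a , b)))

  reach-sym : ∀ {E x y} → Reach E x y → Reach E y x
  reach-sym = Star.reverse (Sym.symmetric _)

  reach-mono : ∀ {E E'} → (∀ {g} → E g → E' g) → ∀ {x y} → Reach E x y → Reach E' x y
  reach-mono f = Star.map (Sym.map f)

  reach-bind : ∀ {E E'} → (∀ {a b} → E (a , b) → Reach E' a b) → ∀ {x y} → Reach E x y → Reach E' x y
  reach-bind f = Sym.fold reach-sym f Star.⋆

  reach-avoid : ∀ {E} f {x y} → Reach E x y
              → Reach (E ∖ f) x y ⊎ Reach (E ∖ f) x (proj₁ f) ⊎ Reach (E ∖ f) x (proj₂ f)
  reach-avoid f ε = inj₁ ε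
  reach-avoid f (_◅_ {x} {w} (fwd e) r) with (x , w) ≟E f
  ... | yes refl = inj₂ (inj₁ ε)
  ... | no ≢f = Sum.map (fwd (e , ≢f) ◅_) (Sum.map (fwd (e , ≢f) ◅_) (fwd (e , ≢f) ◅_)) (reach-avoid f r)
  reach-avoid f (_◅_ {x} {w} (bwd e) r) with (w , x) ≟E f
  ... | yes refl = inj₂ (inj₂ ε)
  ... | no ≢f = Sum.map (bwd (e , ≢f) ◅_) (Sum.map (bwd (e , ≢f) ◅_) (bwd (e , ≢f) ◅_)) (reach-avoid f r)

  reach-[] : ∀ {x y} → Reach (InList []) x y → x ≡ y
  reach-[] ε = refl
  reach-[] (fwd () ◅ _)
  reach-[] (bwd () ◅ _)

  ReachVia : Edge {n} → List (Edge {n}) → V {n} → V {n} → Set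
  ReachVia (a , b) es x y = R x y ⊎ (R x a × R b y) ⊎ (R x b × R a y)
    where R = Reach (InList es)

  reach-∷⁻ : ∀ {a b es x y} → Reach (InList ((a , b) ∷ es)) x y → ReachVia (a , b) es x y
  reach-∷⁻ ε = inj₁ ε
  reach-∷⁻ (fwd (here refl) ◅ r) with reach-∷⁻ r
  ... | inj₁ q = inj₂ (inj₁ (ε , q))
  ... | inj₂ (inj₁ (q , q')) = inj₁ (reach-sym q ◅◅ q')
  ... | inj₂ (inj₂ (_ , q')) = inj₁ q'
  reach-∷⁻ (fwd (there m) ◅ r) with reach-∷⁻ r
  ... | inj₁ q = inj₁ (fwd m ◅ q)
  ... | inj₂ (inj₁ (q , q')) = inj₂ (inj₁ (fwd m ◅ q , q'))
  ... | inj₂ (inj₂ (q , q')) = inj₂ (inj₂ (fwd m ◅ q , q'))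
  reach-∷⁻ (bwd (here refl) ◅ r) with reach-∷⁻ r
  ... | inj₁ q = inj₂ (inj₂ (ε , q))
  ... | inj₂ (inj₁ (_ , q')) = inj₁ q'
  ... | inj₂ (inj₂ (q , q')) = inj₁ (reach-sym q ◅◅ q')
  reach-∷⁻ (bwd (there m) ◅ r) with reach-∷⁻ r
  ... | inj₁ q = inj₁ (bwd m ◅ q)
  ... | inj₂ (inj₁ (q , q')) = inj₂ (inj₁ (bwd m ◅ q , q'))
  ... | inj₂ (inj₂ (q , q')) = inj₂ (inj₂ (bwd m ◅ q , q'))

  reach-∷⁺ : ∀ {a b es x y} → ReachVia (a , b) es x y → Reach (InList ((a , b) ∷ es)) x y
  reach-∷⁺ (inj₁ q) = reach-mono there q
  reach-∷⁺ (inj₂ (inj₁ (q , q'))) = reach-mono there q ◅◅ fwd (here refl) ◅ reach-mono there q'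
  reach-∷⁺ (inj₂ (inj₂ (q , q'))) = reach-mono there q ◅◅ bwd (here refl) ◅ reach-mono there q'

  reach? : ∀ es x y → Dec (Reach (InList es) x y)
  reach? [] x y = map′ (λ { refl → ε }) reach-[] (x ≟V y)
  reach? ((a , b) ∷ es) x y = map′ reach-∷⁺ reach-∷⁻
    (reach? es x y ⊎-dec ((reach? es x a ×-dec reach? es b y) ⊎-dec (reach? es x b ×-dec reach? es a y)))

  Joins : Edge {n} → V {n} → V {n} → Set
  Joins e x y = e ≡ (x , y) ⊎ e ≡ (y , x)

  joins-sym : ∀ {e x y} → Joins e x y → Joins e y x
  joins-sym (inj₁ eq) = inj₂ eq
  joins-sym (inj₂ eq) = inj₁ eq

  joins⇒incident : ∀ {e x y} → Joins e x y → Incident x e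
  joins⇒incident (inj₁ refl) = inj₁ refl
  joins⇒incident (inj₂ refl) = inj₂ refl

  incident⇒joins : ∀ {v} e → Incident v e → Joins e v (other v e)
  incident⇒joins {v} (a , b) v∈e with a ≟V v | v∈e
  ... | yes refl | _ = inj₁ refl
  ... | no a≢v | inj₁ a≡v = ⊥-elim (a≢v a≡v)
  ... | no _ | inj₂ refl = inj₂ refl

  incident-joins : ∀ {e x y z} → Joins e x y → Incident z e → z ≡ x ⊎ z ≡ y
  incident-joins (inj₁ refl) (inj₁ refl) = inj₁ refl
  incident-joins (inj₁ refl) (inj₂ refl) = inj₂ refl
  incident-joins (inj₂ refl) (inj₁ refl) = inj₂ refl
  incident-joins (inj₂ refl) (inj₂ refl) = inj₁ refl

  joins-injective : ∀ {e v x y} → Joins e v x → Joins e v y → v ≢ x → x ≡ y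
  joins-injective (inj₁ refl) (inj₁ refl) _ = refl
  joins-injective (inj₁ refl) (inj₂ refl) v≢x = ⊥-elim (v≢x refl)
  joins-injective (inj₂ refl) (inj₁ refl) v≢x = ⊥-elim (v≢x refl)
  joins-injective (inj₂ refl) (inj₂ refl) _ = refl

  reach-edge : ∀ {E e x y} → E e → Joins e x y → Reach E x y
  reach-edge e∈E (inj₁ refl) = fwd e∈E ◅ ε
  reach-edge e∈E (inj₂ refl) = bwd e∈E ◅ ε

  joins⇒adj : ∀ {G : Graph {n}} {e x y} → e ∈ edges G → Joins e x y → Adj G x y
  joins⇒adj m (inj₁ refl) = inj₁ m
  joins⇒adj m (inj₂ refl) = inj₂ m

  reach⇒conn : ∀ {G : Graph {n}} {x y} → Reach (InList (edges G)) x y → y ∈ verts G → Conn G x y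
  reach⇒conn ε y∈ = here y∈
  reach⇒conn (fwd m ◅ r) y∈ = there (inj₁ m) (reach⇒conn r y∈)
  reach⇒conn (bwd m ◅ r) y∈ = there (inj₂ m) (reach⇒conn r y∈)

  conn⇒reach : ∀ {G : Graph {n}} {x y} → Conn G x y → Reach (InList (edges G)) x y × y ∈ verts G
  conn⇒reach (here y∈) = ε , y∈
  conn⇒reach (there (inj₁ m) w~y) = Product.map₁ (fwd m ◅_) (conn⇒reach w~y)
  conn⇒reach (there (inj₂ m) w~y) = Product.map₁ (bwd m ◅_) (conn⇒reach w~y)

  conn? : ∀ (G : Graph {n}) x y → Dec (Conn G x y)
  conn? G x y with _∈?_ _≟V_ y (verts G)
  ... | no y∉ = no (y∉ ∘ proj₂ ∘ conn⇒reach)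
  ... | yes y∈ = map′ (λ r → reach⇒conn r y∈) (proj₁ ∘ conn⇒reach) (reach? (edges G) x y)

  -- acyclic deletes every copy of an edge, so parallel edges are excluded by edges-unique.
  record ForestWith (InternalDeg : ℕ → Set) (S : List (Fin n)) (G : Graph {n}) : Set where
    field
      labels-unique : Unique S
      edges-unique : Unique (edges G)
      endpoints : ∀ {a b} → (a , b) ∈ edges G → a ∈ verts G × b ∈ verts G × a ≢ b
      acyclic : ∀ {a b} → (a , b) ∈ edges G → ¬ Reach (InList (edges G) ∖ (a , b)) a b
      label⇒∈S : ∀ x → inj₁ x ∈ verts G → x ∈ S
      ∈S⇒label : ∀ x → x ∈ S → inj₁ x ∈ verts G
      leaf-deg : ∀ x → deg G (inj₁ x) ≤ 1
      internal-deg : ∀ k → inj₂ k ∈ verts G → InternalDeg (deg G (inj₂ k))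

  Forest : List (Fin n) → Graph {n} → Set
  Forest = ForestWith (_≡ 3)

  -- Deleting an edge or a leaf leaves internal vertices of degree two until they are suppressed.
  Preforest : List (Fin n) → Graph {n} → Set
  Preforest = ForestWith (λ d → d ≡ 2 ⊎ d ≡ 3)

  module _ {D S} {G : Graph {n}} (I : ForestWith D S G) where
    open ForestWith I

    joins-endpoints : ∀ {e x y} → e ∈ edges G → Joins e x y → x ∈ verts G × y ∈ verts G × x ≢ y
    joins-endpoints m (inj₁ refl) = endpoints m
    joins-endpoints m (inj₂ refl) with endpoints m
    ... | a∈ , b∈ , a≢b = b∈ , a∈ , a≢b ∘ sym

    acyclic-joins : ∀ {e x y} → e ∈ edges G → Joins e x y → ¬ Reach (InList (edges G) ∖ e) x y
    acyclic-joins m (inj₁ refl) r = acyclic m r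
    acyclic-joins m (inj₂ refl) r = acyclic m (reach-sym r)

    deg≥2⇒internal : ∀ {v} → 2 ≤ deg G v → ∃ λ k → v ≡ inj₂ k
    deg≥2⇒internal {inj₁ x} 2≤d with ≤-trans 2≤d (leaf-deg x)
    ... | s≤s ()
    deg≥2⇒internal {inj₂ k} _ = k , refl

    no-parallel : ∀ {e e' x y} → e ∈ edges G → e' ∈ edges G → e ≢ e' → Joins e x y → ¬ Joins e' x y
    no-parallel e∈ e'∈ e≢e' j j' = acyclic-joins e∈ j (reach-edge (e'∈ , e≢e' ∘ sym) j')

  isForestOnX⇒Forest : ∀ {F : Graph {n}} → IsForestOnX F → Forest (allFin n) F
  isForestOnX⇒Forest {F} (_ , endpoints , cut , leaves , leaf-deg , internal-deg) = record
    { labels-unique = allFin⁺ n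
    ; edges-unique = ∉-─⇒Unique λ p m → cut p (reach⇒conn (fwd m ◅ ε) (proj₁ (proj₂ (endpoints p))))
    ; endpoints = endpoints
    ; acyclic = λ p r →
        cut p (reach⇒conn (reach-mono (λ (m , ≢) → ∈-─⁺ p m ≢) r) (proj₁ (proj₂ (endpoints p))))
    ; label⇒∈S = λ x _ → ∈-allFin x
    ; ∈S⇒label = λ x _ → leaves x
    ; leaf-deg = leaf-deg
    ; internal-deg = internal-deg
    }

  removeVertex : Graph {n} → V {n} → Graph {n}
  removeVertex G v =
    graph (filter (λ u → ¬? (u ≟V v)) (verts G)) (filter (λ e → ¬? (Incident? v e)) (edges G))

  removeVertex-endpoints : ∀ {D S} {G : Graph {n}} → ForestWith D S G → ∀ {v a b} → (a , b) ∈ edges (removeVertex G v)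
                         → a ∈ verts (removeVertex G v) × b ∈ verts (removeVertex G v) × a ≢ b
  removeVertex-endpoints I {v} m with ∈-filter⁻ (λ e → ¬? (Incident? v e)) m
  ... | m' , v∉ab with ForestWith.endpoints I m'
  ...   | a∈ , b∈ , a≢b = ∈-filter⁺ ≢v? a∈ (v∉ab ∘ inj₁) , ∈-filter⁺ ≢v? b∈ (v∉ab ∘ inj₂) , a≢b
    where ≢v? = λ u → ¬? (u ≟V v)

  -- Suppressing degree-two vertices

  Degree2 : Graph {n} → V {n} → Set
  Degree2 G w = w ∈ verts G × deg G w ≡ 2

  -- G' arises from G by suppressing the vertices of l in turn.
  record Suppressed (S : List (Fin n)) (G G' : Graph {n}) (l : List (V {n})) : Set where
    field
      preforest : Preforest S G'
      verts⊆ : ∀ {w} → w ∉ l → w ∈ verts G' → w ∈ verts G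
      deg≡ : ∀ {w} → w ∉ l → deg G' w ≡ deg G w
      ¬degree2 : ∀ {w} → w ∈ l → ¬ Degree2 G' w
      edges≤ : length (edges G') ≤ length (edges G)

  suppressed-[] : ∀ {S G} → Preforest S G → Suppressed S G G []
  suppressed-[] I = record
    { preforest = I ; verts⊆ = λ _ m → m ; deg≡ = λ _ → refl ; ¬degree2 = λ () ; edges≤ = ≤-refl }

  suppressed-∷ : ∀ {S G H H' l v} → Suppressed S G H l → Suppressed S H H' [ v ] → Suppressed S G H' (v ∷ l)
  suppressed-∷ {H' = H'} {l} {v} A B = record
    { preforest = B.preforest
    ; verts⊆ = λ w∉ → A.verts⊆ (w∉ ∘ there) ∘ B.verts⊆ (≢⇒∉[] (w∉ ∘ here))
    ; deg≡ = λ w∉ → trans (B.deg≡ (≢⇒∉[] (w∉ ∘ here))) (A.deg≡ (w∉ ∘ there))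
    ; ¬degree2 = ¬degree2
    ; edges≤ = ≤-trans B.edges≤ A.edges≤
    }
    where
    module A = Suppressed A
    module B = Suppressed B
    ¬degree2 : ∀ {w} → w ∈ v ∷ l → ¬ Degree2 H' w
    ¬degree2 (here refl) = B.¬degree2 (here refl)
    ¬degree2 {w} (there w∈l) with w ≟V v
    ... | yes refl = B.¬degree2 (here refl)
    ... | no w≢v = λ (w∈ , d) →
      A.¬degree2 w∈l (B.verts⊆ (≢⇒∉[] w≢v) w∈ , trans (sym (B.deg≡ (≢⇒∉[] w≢v))) d)

  unsuppressed : ∀ {S G v} → Preforest S G → ¬ Degree2 G v → Suppressed S G G [ v ]
  unsuppressed I ¬d2 = record
    { preforest = I ; verts⊆ = λ _ m → m ; deg≡ = λ _ → refl
    ; ¬degree2 = λ { (here refl) → ¬d2 } ; edges≤ = ≤-refl }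

  module SuppressAt {S : List (Fin n)} {G : Graph {n}} (I : Preforest S G) {v e₁ e₂ u w}
                    (e₁∈ : e₁ ∈ edges G) (e₂∈ : e₂ ∈ edges G) (j₁ : Joins e₁ v u) (j₂ : Joins e₂ v w)
                    (u≢w : u ≢ w) (at-v : filter (Incident? v) (edges G) ≡ e₁ ∷ e₂ ∷ []) where
    open ForestWith I

    ≢v? : Decidable (_≢ v)
    ≢v? x = ¬? (x ≟V v)

    away? : Decidable (λ e → ¬ Incident v e)
    away? e = ¬? (Incident? v e)

    es₀ : List Edge
    es₀ = filter away? (edges G)

    G' : Graph {n}
    G' = graph (filter ≢v? (verts G)) ((u , w) ∷ es₀)

    v≢u : v ≢ u
    v≢u = proj₂ (proj₂ (joins-endpoints I e₁∈ j₁))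

    v≢w : v ≢ w
    v≢w = proj₂ (proj₂ (joins-endpoints I e₂∈ j₂))

    label≢v : ∀ x → inj₁ x ≢ v
    label≢v x x≡v with deg≥2⇒internal I (≤-reflexive (sym (cong length at-v)))
    ... | _ , refl with x≡v
    ... | ()

    away⇒≢ : ∀ {e e'} → ¬ Incident v e → Joins e' v u ⊎ Joins e' v w → e ≢ e'
    away⇒≢ v∉e (inj₁ j) refl = v∉e (joins⇒incident j)
    away⇒≢ v∉e (inj₂ j) refl = v∉e (joins⇒incident j)

    away-uw : ¬ Incident v (u , w)
    away-uw (inj₁ u≡v) = v≢u (sym u≡v)
    away-uw (inj₂ w≡v) = v≢w (sym w≡v)

    other-end : ∀ {e y x} → Joins e v y → x ≢ v → Incident x e → y ≡ x
    other-end j x≢v x∈e = [ ⊥-elim ∘ x≢v , sym ]′ (incident-joins j x∈e)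

    deg≡ : ∀ {x} → x ≢ v → deg G' x ≡ deg G x
    deg≡ {x} x≢v = begin
      count (Incident? x) ([ (u , w) ] ++ es₀)
        ≡⟨ count-++ (Incident? x) [ (u , w) ] es₀ ⟩
      count (Incident? x) [ (u , w) ] + count (Incident? x) es₀
        ≡⟨ cong (_+ count (Incident? x) es₀) (sym (count-pair (Incident? x) split end₁ end₂ disjoint)) ⟩
      count (Incident? x) (e₁ ∷ e₂ ∷ []) + count (Incident? x) es₀
        ≡⟨ cong (λ l → count (Incident? x) l + count (Incident? x) es₀) (sym at-v) ⟩
      count (Incident? x) (filter (Incident? v) (edges G)) + count (Incident? x) es₀
        ≡⟨ sym (count-partition (Incident? x) (Incident? v) (edges G)) ⟩
      deg G x ∎
      where
      open ≡-Reasoning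
      split : Incident x (u , w) → Incident x e₁ ⊎ Incident x e₂
      split (inj₁ refl) = inj₁ (joins⇒incident (joins-sym j₁))
      split (inj₂ refl) = inj₂ (joins⇒incident (joins-sym j₂))
      end₁ : Incident x e₁ → Incident x (u , w)
      end₁ = inj₁ ∘ other-end j₁ x≢v
      end₂ : Incident x e₂ → Incident x (u , w)
      end₂ = inj₂ ∘ other-end j₂ x≢v
      disjoint : ¬ (Incident x e₁ × Incident x e₂)
      disjoint (x∈e₁ , x∈e₂) = u≢w (trans (other-end j₁ x≢v x∈e₁) (sym (other-end j₂ x≢v x∈e₂)))

    u~w : ∀ {f} → ¬ Incident v f → Reach (InList (edges G) ∖ f) u w
    u~w v∉f = reach-edge (e₁∈ , away⇒≢ v∉f (inj₁ j₁) ∘ sym) (joins-sym j₁)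
           ◅◅ reach-edge (e₂∈ , away⇒≢ v∉f (inj₂ j₂) ∘ sym) j₂

    uw∉es₀ : (u , w) ∉ es₀
    uw∉es₀ m = acyclic (proj₁ (∈-filter⁻ away? m)) (u~w away-uw)

    endpoints' : ∀ {a b} → (a , b) ∈ edges G' → a ∈ verts G' × b ∈ verts G' × a ≢ b
    endpoints' (here refl) =
      ∈-filter⁺ ≢v? (proj₁ (proj₂ (joins-endpoints I e₁∈ j₁))) (v≢u ∘ sym) ,
      ∈-filter⁺ ≢v? (proj₁ (proj₂ (joins-endpoints I e₂∈ j₂))) (v≢w ∘ sym) , u≢w
    endpoints' (there m) = removeVertex-endpoints I m

    acyclic' : ∀ {a b} → (a , b) ∈ edges G' → ¬ Reach (InList (edges G') ∖ (a , b)) a b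
    acyclic' (here refl) r =
      acyclic-joins I e₁∈ j₁ (reach-sym (reach-mono old r ◅◅ reach-edge (e₂∈ , e₂≢e₁) (joins-sym j₂)))
      where
      old : ∀ {g} → (InList (edges G') ∖ (u , w)) g → (InList (edges G) ∖ e₁) g
      old (here refl , ≢uw) = ⊥-elim (≢uw refl)
      old (there m , _) with ∈-filter⁻ away? m
      ... | m' , v∉g = m' , away⇒≢ v∉g (inj₁ j₁)
      e₂≢e₁ : e₂ ≢ e₁
      e₂≢e₁ refl = u≢w (joins-injective j₁ j₂ v≢u)
    acyclic' {a} {b} (there m) r with ∈-filter⁻ away? m
    ... | ab∈ , v∉ab = acyclic ab∈ (reach-bind old r)
      where
      old : ∀ {x y} → (InList (edges G') ∖ (a , b)) (x , y) → Reach (InList (edges G) ∖ (a , b)) x y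
      old (here refl , _) = u~w v∉ab
      old (there m' , ≢ab) = fwd (proj₁ (∈-filter⁻ away? m') , ≢ab) ◅ ε

    preforest : Preforest S G'
    preforest = record
      { labels-unique = labels-unique
      ; edges-unique = ¬Any⇒All¬ es₀ uw∉es₀ ∷ filter⁺ away? edges-unique
      ; endpoints = endpoints'
      ; acyclic = acyclic'
      ; label⇒∈S = λ x m → label⇒∈S x (proj₁ (∈-filter⁻ ≢v? {xs = verts G} m))
      ; ∈S⇒label = λ x m → ∈-filter⁺ ≢v? (∈S⇒label x m) (label≢v x)
      ; leaf-deg = λ x → subst (_≤ 1) (sym (deg≡ (label≢v x))) (leaf-deg x)
      ; internal-deg = λ k m → let m' , k≢v = ∈-filter⁻ ≢v? {xs = verts G} m in
          subst (λ d → d ≡ 2 ⊎ d ≡ 3) (sym (deg≡ k≢v)) (internal-deg k m')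
      }

    suppressed : Suppressed S G G' [ v ]
    suppressed = record
      { preforest = preforest
      ; verts⊆ = λ _ m → proj₁ (∈-filter⁻ ≢v? {xs = verts G} m)
      ; deg≡ = λ x∉ → deg≡ (x∉ ∘ here)
      ; ¬degree2 = λ { (here refl) (m , _) → proj₂ (∈-filter⁻ ≢v? {xs = verts G} m) refl }
      ; edges≤ = filter-notAll away? (edges G) (Any.map (λ { refl v∉e₁ → v∉e₁ (joins⇒incident j₁) }) e₁∈)
      }

  incident-edges-≢2 : ∀ {G : Graph {n}} {v es} → filter (Incident? v) (edges G) ≡ es → length es ≢ 2 → ¬ Degree2 G v
  incident-edges-≢2 eq ≢2 (_ , d) = ≢2 (trans (sym (cong length eq)) d)

  incident-edges-pair : ∀ {D S} {G : Graph {n}} → ForestWith D S G → ∀ {v e₁ e₂}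
                      → filter (Incident? v) (edges G) ≡ e₁ ∷ e₂ ∷ []
                      → (e₁ ∈ edges G × Incident v e₁) × (e₂ ∈ edges G × Incident v e₂) × e₁ ≢ e₂
  incident-edges-pair I {v} eq with subst Unique eq (filter⁺ (Incident? v) (ForestWith.edges-unique I))
  ... | (e₁≢e₂ ∷ []) ∷ _ = ∈-filter⁻ (Incident? v) (subst (_ ∈_) (sym eq) (here refl))
                         , ∈-filter⁻ (Incident? v) (subst (_ ∈_) (sym eq) (there (here refl))) , e₁≢e₂

  suppressV-suppressed : ∀ {S} (G : Graph {n}) v → Preforest S G → Suppressed S G (suppressV v G) [ v ]
  suppressV-suppressed G v I with filter (Incident? v) (edges G) in at-v
  ... | [] = unsuppressed I (incident-edges-≢2 {G} at-v λ ())
  ... | _ ∷ [] = unsuppressed I (incident-edges-≢2 {G} at-v λ ())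
  ... | _ ∷ _ ∷ _ ∷ _ = unsuppressed I (incident-edges-≢2 {G} at-v λ ())
  ... | e₁ ∷ e₂ ∷ [] with incident-edges-pair I at-v | other v e₁ ≟V other v e₂
  ...   | (e₁∈ , v∈e₁) , (e₂∈ , v∈e₂) , e₁≢e₂ | yes same =
          ⊥-elim (no-parallel I e₁∈ e₂∈ e₁≢e₂ (incident⇒joins e₁ v∈e₁)
                                             (subst (Joins e₂ v) (sym same) (incident⇒joins e₂ v∈e₂)))
  ...   | (e₁∈ , v∈e₁) , (e₂∈ , v∈e₂) , _ | no differ =
          SuppressAt.suppressed I e₁∈ e₂∈ (incident⇒joins e₁ v∈e₁) (incident⇒joins e₂ v∈e₂) differ at-v

  foldr-suppressV-suppressed : ∀ {S} l (G : Graph {n}) → Preforest S G → Suppressed S G (foldr suppressV G l) l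
  foldr-suppressV-suppressed [] G I = suppressed-[] I
  foldr-suppressV-suppressed (v ∷ l) G I = suppressed-∷ A (suppressV-suppressed _ v (Suppressed.preforest A))
    where A = foldr-suppressV-suppressed l G I

  preforest⇒forest : ∀ {S G} → Preforest S G → (∀ {w} → ¬ Degree2 G w) → Forest S G
  preforest⇒forest {G = G} I ¬degree2 = record
    { labels-unique = labels-unique ; edges-unique = edges-unique
    ; endpoints = endpoints ; acyclic = acyclic ; label⇒∈S = label⇒∈S ; ∈S⇒label = ∈S⇒label
    ; leaf-deg = leaf-deg
    ; internal-deg = λ k m → [ (λ d2 → ⊥-elim (¬degree2 (m , d2))) , id ]′ (internal-deg k m)
    }
    where open ForestWith I

  suppressAll-forest : ∀ {S} {G : Graph {n}} → Preforest S G
                     → Forest S (suppressAll G) × length (edges (suppressAll G)) ≤ length (edges G)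
  suppressAll-forest {G = G} I = preforest⇒forest preforest no-degree2 , edges≤
    where
    open Suppressed (foldr-suppressV-suppressed (verts G) G I)
    no-degree2 : ∀ {w} → ¬ Degree2 (suppressAll G) w
    no-degree2 {w} d2 with _∈?_ _≟V_ w (verts G)
    ... | yes w∈ = ¬degree2 w∈ d2
    ... | no w∉ = w∉ (verts⊆ w∉ (proj₁ d2))

  drop≤1-from-3 : ∀ {d d'} → d ≡ 3 → d' ≤ d → d ≤ suc d' → d' ≡ 2 ⊎ d' ≡ 3
  drop≤1-from-3 {d' = 2} _ _ _ = inj₁ refl
  drop≤1-from-3 {d' = 3} _ _ _ = inj₂ refl
  drop≤1-from-3 {d' = 0} refl _ (s≤s ())
  drop≤1-from-3 {d' = 1} refl _ (s≤s (s≤s ()))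
  drop≤1-from-3 {d' = suc (suc (suc (suc _)))} refl (s≤s (s≤s (s≤s ()))) _

  removeLabel : List (Fin n) → Fin n → List (Fin n)
  removeLabel S x = filter (λ z → ¬? (z Fin.≟ x)) S

  length-removeLabel : ∀ {S x} → Unique S → x ∈ S → length S ≡ suc (length (removeLabel S x))
  length-removeLabel {y ∷ S} (y∉S ∷ _) (here refl)
    rewrite filter-reject (λ z → ¬? (z Fin.≟ y)) {y} {S} (λ y≢y → y≢y refl)
          | filter-all (λ z → ¬? (z Fin.≟ y)) (All.map (_∘ sym) y∉S) = refl
  length-removeLabel {y ∷ S} {x} (y∉S ∷ u) (there x∈S)
    rewrite filter-accept (λ z → ¬? (z Fin.≟ x)) {y} {S} (λ { refl → All¬⇒¬Any y∉S x∈S })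
    = cong suc (length-removeLabel u x∈S)

  module _ {S} {G : Graph {n}} (I : Forest S G) where
    open ForestWith I

    removeEdge-preforest : ∀ {e} (q : e ∈ edges G) → Preforest S (removeEdge G q)
    removeEdge-preforest q = record
      { labels-unique = labels-unique
      ; edges-unique = Unique-─ edges-unique q
      ; endpoints = endpoints ∘ ∈-─⁻ q
      ; acyclic = λ m r → acyclic (∈-─⁻ q m) (reach-mono (Product.map₁ (∈-─⁻ q)) r)
      ; label⇒∈S = label⇒∈S
      ; ∈S⇒label = ∈S⇒label
      ; leaf-deg = λ x → ≤-trans (proj₁ (count-─ (Incident? (inj₁ x)) q)) (leaf-deg x)
      ; internal-deg = λ k m → let lo , hi = count-─ (Incident? (inj₂ k)) q in drop≤1-from-3 (internal-deg k m) lo hi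
      }

    deleteEdge-forest : ∀ {e} (q : e ∈ edges G)
                      → Forest S (deleteEdge G q) × length (edges (deleteEdge G q)) < length (edges G)
    deleteEdge-forest q with suppressAll-forest (removeEdge-preforest q)
    ... | F , edges≤ = F , ≤-trans (s≤s edges≤) (≤-reflexive (sym (length-─ q)))

    module _ (x : Fin n) where
      private
        ≢x? : Decidable (_≢ inj₁ x)
        ≢x? u = ¬? (u ≟V inj₁ x)
        away? : Decidable (λ e → ¬ Incident (inj₁ x) e)
        away? e = ¬? (Incident? (inj₁ x) e)

      removeVertex-deg≥ : ∀ k → deg G (inj₂ k) ≤ suc (deg (removeVertex G (inj₁ x)) (inj₂ k))
      removeVertex-deg≥ k = begin
        deg G (inj₂ k)
          ≡⟨ count-partition (Incident? (inj₂ k)) (Incident? (inj₁ x)) (edges G) ⟩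
        count (Incident? (inj₂ k)) (filter (Incident? (inj₁ x)) (edges G)) + deg (removeVertex G (inj₁ x)) (inj₂ k)
          ≤⟨ +-monoˡ-≤ _ (≤-trans (length-filter (Incident? (inj₂ k)) (filter (Incident? (inj₁ x)) (edges G)))
                                  (leaf-deg x)) ⟩
        suc (deg (removeVertex G (inj₁ x)) (inj₂ k)) ∎
        where open ≤-Reasoning

      removeVertex-preforest : Preforest (removeLabel S x) (removeVertex G (inj₁ x))
      removeVertex-preforest = record
        { labels-unique = filter⁺ _ labels-unique
        ; edges-unique = filter⁺ away? edges-unique
        ; endpoints = removeVertex-endpoints I
        ; acyclic = λ m r →
            acyclic (proj₁ (∈-filter⁻ away? m)) (reach-mono (Product.map₁ (proj₁ ∘ ∈-filter⁻ away?)) r)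
        ; label⇒∈S = λ z m → let z∈ , z≢x = ∈-filter⁻ ≢x? {xs = verts G} m in
            ∈-filter⁺ (λ z → ¬? (z Fin.≟ x)) (label⇒∈S z z∈) (z≢x ∘ cong inj₁)
        ; ∈S⇒label = λ z m → let z∈ , z≢x = ∈-filter⁻ (λ z → ¬? (z Fin.≟ x)) m in
            ∈-filter⁺ ≢x? (∈S⇒label z z∈) (z≢x ∘ inj₁-injective)
        ; leaf-deg = λ z → ≤-trans (count-filter≤ (Incident? (inj₁ z)) away? (edges G)) (leaf-deg z)
        ; internal-deg = λ k m → let k∈ = proj₁ (∈-filter⁻ ≢x? {xs = verts G} m) in
            drop≤1-from-3 (internal-deg k k∈) (count-filter≤ (Incident? (inj₂ k)) away? (edges G)) (removeVertex-deg≥ k)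
        }

      deleteLeaf-forest : Forest (removeLabel S x) (deleteLeaf G x) × length (edges (deleteLeaf G x)) ≤ length (edges G)
      deleteLeaf-forest with suppressAll-forest removeVertex-preforest
      ... | F , edges≤ = F , ≤-trans edges≤ (length-filter away? (edges G))

  -- Every forest with an edge has a cherry

  CherryIn : Graph {n} → Set
  CherryIn G = ∃₂ λ x y → Cherry G x y

  module _ {S} {G : Graph {n}} (I : Forest S G) where
    open ForestWith I

    record Fork (v : V {n}) (e₀ : Edge {n}) (a₁ a₂ : V {n}) : Set where
      field
        f₁ f₂ : Edge {n}
        f₁∈ : f₁ ∈ edges G
        f₂∈ : f₂ ∈ edges G
        joins₁ : Joins f₁ v a₁
        joins₂ : Joins f₂ v a₂
        f₁≢e₀ : f₁ ≢ e₀
        f₂≢e₀ : f₂ ≢ e₀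
        f₁≢f₂ : f₁ ≢ f₂

    fork : ∀ {v e₀} → deg G v ≡ 3 → e₀ ∈ edges G → Incident v e₀ → ∃₂ (Fork v e₀)
    fork {v} d3 e₀∈ v∈e₀
      with other-two d3 (filter⁺ (Incident? v) edges-unique) (∈-filter⁺ (Incident? v) e₀∈ v∈e₀)
    ... | f₁ , f₂ , m₁ , m₂ , f₁≢e₀ , f₂≢e₀ , f₁≢f₂
        with ∈-filter⁻ (Incident? v) m₁ | ∈-filter⁻ (Incident? v) m₂
    ...   | f₁∈ , v∈f₁ | f₂∈ , v∈f₂ = _ , _ , record
            { f₁ = f₁ ; f₂ = f₂ ; f₁∈ = f₁∈ ; f₂∈ = f₂∈
            ; joins₁ = incident⇒joins f₁ v∈f₁ ; joins₂ = incident⇒joins f₂ v∈f₂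
            ; f₁≢e₀ = f₁≢e₀ ; f₂≢e₀ = f₂≢e₀ ; f₁≢f₂ = f₁≢f₂ }

    -- The walk has just crossed e₀ from p; H holds the edges still ahead of it.
    Behind : List (Edge {n}) → V {n} → Edge {n} → Set
    Behind H p e₀ = ∀ {g} → g ∈ edges G → g ∉ H
                  → g ≡ e₀ ⊎ ∃ λ z → Incident z g × Reach (InList (edges G) ∖ e₀) p z

    behind-start : ∀ {p e} (q : e ∈ edges G) → Behind (edges G ─ q) p e
    behind-start {e = e} q {g} g∈ g∉ with g ≟E e
    ... | yes g≡e = inj₁ g≡e
    ... | no g≢e = ⊥-elim (g∉ (∈-─⁺ q g∈ g≢e))

    edge-ahead-unreachable : ∀ {p v e₀ f a z} → e₀ ∈ edges G → Joins e₀ p v → f ∈ edges G → f ≢ e₀ → Joins f v a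
                           → Incident z f → ¬ Reach (InList (edges G) ∖ e₀) p z
    edge-ahead-unreachable e₀∈ j₀ f∈ f≢e₀ jf z∈f p~z with incident-joins jf z∈f
    ... | inj₁ refl = acyclic-joins I e₀∈ j₀ p~z
    ... | inj₂ refl = acyclic-joins I e₀∈ j₀ (p~z ◅◅ reach-edge (f∈ , f≢e₀) (joins-sym jf))

    ahead : ∀ {H p v e₀ f a} → e₀ ∈ edges G → Joins e₀ p v → Behind H p e₀
          → f ∈ edges G → f ≢ e₀ → Joins f v a → f ∈ H
    ahead {H} {f = f} e₀∈ j₀ behind f∈ f≢e₀ jf with _∈?_ _≟E_ f H
    ... | yes f∈H = f∈H
    ... | no f∉H with behind f∈ f∉H
    ...   | inj₁ f≡e₀ = ⊥-elim (f≢e₀ f≡e₀)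
    ...   | inj₂ (z , z∈f , p~z) = ⊥-elim (edge-ahead-unreachable e₀∈ j₀ f∈ f≢e₀ jf z∈f p~z)

    behind-step : ∀ {H p v e₀ f a} → e₀ ∈ edges G → Joins e₀ p v → Behind H p e₀
                → f ∈ edges G → f ≢ e₀ → Joins f v a → (q : f ∈ H) → Behind (H ─ q) v f
    behind-step {H} {f = f} e₀∈ j₀ behind f∈ f≢e₀ jf q {g} g∈ g∉ with _∈?_ _≟E_ g H
    ... | yes g∈H with g ≟E f
    ...   | yes g≡f = inj₁ g≡f
    ...   | no g≢f = ⊥-elim (g∉ (∈-─⁺ q g∈H g≢f))
    behind-step {H} {v = v} {f = f} e₀∈ j₀ behind f∈ f≢e₀ jf q {g} g∈ g∉ | no g∉H with behind g∈ g∉H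
    ... | inj₁ refl = inj₂ (v , joins⇒incident (joins-sym j₀) , ε)
    ... | inj₂ (z , z∈g , p~z) with reach-avoid f p~z
    ...   | inj₁ p~z' =
            inj₂ (z , z∈g , reach-edge (e₀∈ , f≢e₀ ∘ sym) (joins-sym j₀) ◅◅ reach-mono (Product.map₁ proj₁) p~z')
    ...   | inj₂ (inj₁ p~f) = ⊥-elim (edge-ahead-unreachable e₀∈ j₀ f∈ f≢e₀ jf (inj₁ refl) (reach-mono proj₁ p~f))
    ...   | inj₂ (inj₂ p~f) = ⊥-elim (edge-ahead-unreachable e₀∈ j₀ f∈ f≢e₀ jf (inj₂ refl) (reach-mono proj₁ p~f))

    walk : ∀ k (H : List Edge) → length H < k → Unique H → ∀ {p j e₀}
         → e₀ ∈ edges G → Joins e₀ p (inj₂ j) → Behind H p e₀ → CherryIn G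
    walk (suc k) H (s≤s |H|≤k) uH {p} {j} {e₀} e₀∈ j₀ behind =
      branch (fork (internal-deg j (proj₁ (proj₂ (joins-endpoints I e₀∈ j₀)))) e₀∈ (joins⇒incident (joins-sym j₀)))
      where
      advance : ∀ {f k'} → f ∈ edges G → f ≢ e₀ → Joins f (inj₂ j) (inj₂ k') → CherryIn G
      advance f∈ f≢e₀ jf = walk k (H ─ q) (subst (_≤ k) (length-─ q) |H|≤k) (Unique-─ uH q) f∈ jf
                                (behind-step e₀∈ j₀ behind f∈ f≢e₀ jf q)
        where q = ahead e₀∈ j₀ behind f∈ f≢e₀ jf
      branch : ∃₂ (Fork (inj₂ j) e₀) → CherryIn G
      branch (inj₂ _ , _ , F) = advance f₁∈ f₁≢e₀ joins₁ where open Fork F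
      branch (inj₁ _ , inj₂ _ , F) = advance f₂∈ f₂≢e₀ joins₂ where open Fork F
      branch (inj₁ x , inj₁ y , F) =
        x , y , x≢y , inj₂ (inj₂ j , joins⇒adj {G} f₁∈ (joins-sym joins₁) , joins⇒adj {G} f₂∈ (joins-sym joins₂))
        where
        open Fork F
        x≢y : x ≢ y
        x≢y refl = no-parallel I f₁∈ f₂∈ f₁≢f₂ joins₁ joins₂

    walk-from : ∀ {e p j} → e ∈ edges G → Joins e p (inj₂ j) → CherryIn G
    walk-from m j = walk (length (edges G)) (edges G ─ m) (≤-reflexive (sym (length-─ m))) (Unique-─ edges-unique m)
                         m j (behind-start m)

    edge⇒cherry : ∀ {e} → e ∈ edges G → CherryIn G
    edge⇒cherry {_ , inj₂ _} m = walk-from m (inj₁ refl)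
    edge⇒cherry {inj₂ _ , _} m = walk-from m (inj₂ refl)
    edge⇒cherry {inj₁ x , inj₁ y} m = x , y , proj₂ (proj₂ (endpoints m)) ∘ cong inj₁ , inj₁ (inj₁ m)

  -- Cherry picking

  adj? : ∀ (G : Graph {n}) u w → Dec (Adj G u w)
  adj? G u w = _∈?_ _≟E_ (u , w) (edges G) ⊎-dec _∈?_ _≟E_ (w , u) (edges G)

  adj-sym : ∀ {G : Graph {n}} {u w} → Adj G u w → Adj G w u
  adj-sym (inj₁ m) = inj₂ m
  adj-sym (inj₂ m) = inj₁ m

  cherry-sym : ∀ {G : Graph {n}} {x y} → Cherry G x y → Cherry G y x
  cherry-sym {G} (x≢y , inj₁ adj) = x≢y ∘ sym , inj₁ (adj-sym {G} adj)
  cherry-sym (x≢y , inj₂ (v , x~v , y~v)) = x≢y ∘ sym , inj₂ (v , y~v , x~v)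

  cherry⇒leafEdge : ∀ {G : Graph {n}} {x y} → Cherry G x y → ∃ λ e → e ∈ edges G × IsLeafEdge x e
  cherry⇒leafEdge (_ , inj₁ (inj₁ m)) = _ , m , inj₁ refl
  cherry⇒leafEdge (_ , inj₁ (inj₂ m)) = _ , m , inj₂ refl
  cherry⇒leafEdge (_ , inj₂ (_ , inj₁ m , _)) = _ , m , inj₁ refl
  cherry⇒leafEdge (_ , inj₂ (_ , inj₂ m , _)) = _ , m , inj₂ refl

  isolated? : ∀ (G : Graph {n}) x → Dec (Isolated G x)
  isolated? G x = _∈?_ _≟V_ (inj₁ x) (verts G) ×-dec (deg G (inj₁ x) ℕ.≟ 0)

  module _ {S} {G : Graph {n}} (I : Forest S G) where
    open ForestWith I

    adj⇒∈verts : ∀ {u w} → Adj G u w → u ∈ verts G × w ∈ verts G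
    adj⇒∈verts (inj₁ m) = proj₁ (endpoints m) , proj₁ (proj₂ (endpoints m))
    adj⇒∈verts (inj₂ m) = proj₁ (proj₂ (endpoints m)) , proj₁ (endpoints m)

    cherry⇒∈S : ∀ {x y} → Cherry G x y → x ∈ S × y ∈ S
    cherry⇒∈S (_ , inj₁ adj) = label⇒∈S _ (proj₁ (adj⇒∈verts adj)) , label⇒∈S _ (proj₂ (adj⇒∈verts adj))
    cherry⇒∈S (_ , inj₂ (_ , x~v , y~v)) = label⇒∈S _ (proj₁ (adj⇒∈verts x~v)) , label⇒∈S _ (proj₁ (adj⇒∈verts y~v))

    cherry? : ∀ x y → Dec (Cherry G x y)
    cherry? x y = ¬? (x Fin.≟ y) ×-dec (adj? G (inj₁ x) (inj₁ y) ⊎-dec common-neighbour?)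
      where
      common-neighbour? : Dec (∃ λ v → Adj G (inj₁ x) v × Adj G (inj₁ y) v)
      common-neighbour? = map′ Any.satisfied (λ (v , x~v , y~v) → lose (proj₂ (adj⇒∈verts x~v)) (x~v , y~v))
        (Any.any? (λ v → adj? G (inj₁ x) v ×-dec adj? G (inj₁ y) v) (verts G))

    inCherry? : ∀ x → Dec (InCherry G x)
    inCherry? x = FinP.any? (cherry? x)

  size : List (Fin n) → Graph {n} → Graph {n} → ℕ
  size S F F' = length S + (length (edges F) + length (edges F'))

  size-shrinks : ∀ {s s' f f' g g'} → s ≡ suc s' → g ≤ f → g' ≤ f' → s' + (g + g') < s + (f + f')
  size-shrinks {s' = s'} refl g≤f g'≤f' = s≤s (+-monoʳ-≤ s' (+-mono-≤ g≤f g'≤f'))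

  record Progress (S : List (Fin n)) (F F' : Graph {n}) : Set where
    field
      picked : Fin n
      S' : List (Fin n)
      G G' : Graph {n}
      move : Step picked F F' G G'
      forest : Forest S' G
      forest' : Forest S' G'
      smaller : size S' G G' < size S F F'
      length≤ : length S ≤ suc (length S')
      nonempty : ∃ (_∈ S')

  swap-step : ∀ {x} {F F' G G' : Graph {n}} → Step x F F' G G' → Step x F' F G' G
  swap-step (C1 ch ch') = C1 ch' ch
  swap-step (C2→ r) = C2← r
  swap-step (C2← r) = C2→ r
  swap-step (C3→ iso) = C3← iso
  swap-step (C3← iso) = C3→ iso

  swap-progress : ∀ {S F F'} → Progress S F F' → Progress S F' F
  swap-progress {S} {F} {F'} P = record
    { picked = picked ; S' = S' ; G = G' ; G' = G ; move = swap-step move ; forest = forest' ; forest' = forest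
    ; smaller = subst₂ _<_ (cong (length S' +_) (+-comm (length (edges G)) _))
                           (cong (length S +_) (+-comm (length (edges F)) _)) smaller
    ; length≤ = length≤ ; nonempty = nonempty }
    where open Progress P

  module _ {S} {F F' : Graph {n}} (I : Forest S F) (I' : Forest S F') where

    progress-leaf : ∀ {x z} → Step x F F' (deleteLeaf F x) (deleteLeaf F' x) → x ∈ S → z ∈ S → z ≢ x → Progress S F F'
    progress-leaf {x} {z} st x∈ z∈ z≢x = record
      { picked = x ; S' = removeLabel S x ; G = deleteLeaf F x ; G' = deleteLeaf F' x ; move = st
      ; forest = proj₁ (deleteLeaf-forest I x) ; forest' = proj₁ (deleteLeaf-forest I' x)
      ; smaller = size-shrinks |S| (proj₂ (deleteLeaf-forest I x)) (proj₂ (deleteLeaf-forest I' x))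
      ; length≤ = ≤-reflexive |S|
      ; nonempty = z , ∈-filter⁺ (λ z → ¬? (z Fin.≟ x)) z∈ z≢x }
      where |S| = length-removeLabel (ForestWith.labels-unique I) x∈

    progress-edge : ∀ {x z e} {q : e ∈ edges F} → Step x F F' (deleteEdge F q) F' → z ∈ S → Progress S F F'
    progress-edge {x} {z} {q = q} st z∈ = record
      { picked = x ; S' = S ; G = deleteEdge F q ; G' = F' ; move = st
      ; forest = proj₁ (deleteEdge-forest I q) ; forest' = I'
      ; smaller = +-monoʳ-< (length S) (+-monoˡ-< (length (edges F')) (proj₂ (deleteEdge-forest I q)))
      ; length≤ = n≤1+n _
      ; nonempty = z , z∈ }

    cherry⇒progress : ∀ {x y} → Cherry F x y → Progress S F F'
    cherry⇒progress {x} {y} ch with cherry⇒∈S I ch | cherry⇒leafEdge {F} ch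
    ... | x∈ , y∈ | _ , q , x∈e with cherry? I' x y
    ... | yes ch' = progress-leaf (C1 ch ch') x∈ y∈ (proj₁ ch ∘ sym)
    ... | no ¬ch' with inCherry? I' x
    ...   | yes (z , chz) = progress-edge (C2→ (a-i ch chz (λ { refl → ¬ch' chz }) q (inj₁ x∈e))) x∈
    ...   | no ¬x-cherry with inCherry? I' y
    ...     | yes (z , chz) =
              progress-edge (C2→ (a-i (cherry-sym {F} ch) chz (λ { refl → ¬ch' (cherry-sym {F'} chz) }) q (inj₂ x∈e))) x∈
    ...     | no ¬y-cherry with isolated? F' x
    ...       | yes iso = progress-leaf (C3← iso) x∈ y∈ (proj₁ ch ∘ sym)
    ...       | no ¬x-iso with isolated? F' y
    ...         | yes iso = progress-leaf (C3← iso) y∈ x∈ (proj₁ ch)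
    ...         | no ¬y-iso with conn? F' (inj₁ x) (inj₁ y)
    ...           | yes x~y = progress-edge (C2→ (b-i ch x~y ¬x-cherry ¬y-cherry q (inj₁ x∈e))) x∈
    ...           | no ¬x~y = progress-edge (C2→ (c ch ¬x~y ¬x-iso ¬y-iso ¬x-cherry ¬y-cherry q (inj₁ x∈e))) x∈

  edgeless-singleton : ∀ {x} {G : Graph {n}} → Forest [ x ] G → edges G ≡ [] → IsSingleton G x
  edgeless-singleton {x} {G} I no-edges = (λ v → mk⇔ (only v) λ { refl → ∈S⇒label x (here refl) }) , no-edges
    where
    open ForestWith I
    only : ∀ v → v ∈ verts G → v ≡ inj₁ x
    only (inj₁ z) z∈ with label⇒∈S z z∈
    ... | here refl = refl
    only (inj₂ k) k∈ with trans (sym (internal-deg k k∈)) (cong (count (Incident? (inj₂ k))) no-edges)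
    ... | ()

  Done : List (Fin n) → Graph {n} → Graph {n} → Set
  Done S F F' = ∃ λ x → S ≡ [ x ] × IsSingleton F x × IsSingleton F' x

  progress-or-done : ∀ {S F F'} → Forest S F → Forest S F' → ∃ (_∈ S) → Progress S F F' ⊎ Done S F F'
  progress-or-done {F = graph _ (_ ∷ _)} I I' _ =
    inj₁ (cherry⇒progress I I' (proj₂ (proj₂ (edge⇒cherry I (here refl)))))
  progress-or-done {F = graph _ []} {graph _ (_ ∷ _)} I I' _ =
    inj₁ (swap-progress (cherry⇒progress I' I (proj₂ (proj₂ (edge⇒cherry I' (here refl))))))
  progress-or-done {[]} {graph _ []} {graph _ []} _ _ (_ , ())
  progress-or-done {x ∷ []} {graph _ []} {graph _ []} I I' _ =
    inj₂ (x , refl , edgeless-singleton I refl , edgeless-singleton I' refl)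
  progress-or-done {x ∷ y ∷ _} {graph _ []} {graph _ []} I I' _ =
    inj₁ (progress-leaf I I' (C3→ (ForestWith.∈S⇒label I x (here refl) , refl)) (here refl) (there (here refl)) y≢x)
    where
    y≢x : y ≢ x
    y≢x with ForestWith.labels-unique I
    ... | (x≢y ∷ _) ∷ _ = x≢y ∘ sym

  CherryPicking : List (Fin n) → Graph {n} → Graph {n} → Set
  CherryPicking S F F' = ∃ λ σ → CPS F F' σ × length S ≤ length σ

  cherry-picking : ∀ k {S F F'} → size S F F' < k → Forest S F → Forest S F' → ∃ (_∈ S) → CherryPicking S F F'
  cherry-picking (suc k) lt I I' S≢[] with progress-or-done I I' S≢[]
  ... | inj₂ (x , refl , single , single') = [ x ] , last single single' , ≤-refl
  ... | inj₁ P =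
    let open Progress P
        σ , cps , ≤σ = cherry-picking k (≤-trans smaller (≤-pred lt)) forest forest' nonempty
    in picked ∷ σ , step move cps , ≤-trans length≤ (s≤s ≤σ)

proposition3p2 : (n : ℕ) → 0 < n → (F F' : Graph {n})
    → IsForestOnX F → IsForestOnX F'
    → Σ (List (Fin n)) (λ σ → IsCherryPickingSequence F F' σ × n ≤ length σ)
proposition3p2 ℕ.zero () _ _ _ _
proposition3p2 (suc n) _ F F' isF isF'
  with cherry-picking _ ≤-refl (isForestOnX⇒Forest isF) (isForestOnX⇒Forest isF') (Fin.zero , ∈-allFin Fin.zero)
... | σ , cps , ≤σ = σ , (n≤σ , cps) , n≤σ
  where n≤σ = subst (_≤ length σ) (length-tabulate id) ≤σ
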